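{- Let $G$ be a connected graph with $n>1$ vertices and $M=M[IAS(G)]$. Then the following are equivalent. \begin{enumerate} \item $M$ is not 3-connected. \item $M$ is not cyclically 3-connected. \item $M$ has a circuit of size 2. \item $G$ has a pendant vertex, or a pair of twin vertices. \end{enumerate}
   Context: A graph is a finite looped simple graph; neighbors via non-loop edges, $N_G(v)=\{w\neq v\mid vw\in E(G)\}$. $A(G)$ is the $GF(2)$ adjacency matrix (diagonal 1 iff looped). $M[IAS(G)]$ is the binary matroid represented by $(I\;A(G)\;A(G)+I)$. Distinct $v,w$ are twins if $N_G(v)-\{w\}=N_G(w)-\{v\}$; $v$ is pendant (on $w$) if $N_G(v)=\{w\}$. For a matroid $M$ on $W$ with rank $r$, $\lambda(S)=r(S)+r(W-S)-r(M)$; $S$ is an ordinary $k$-separation if $\lambda(S)<k$ and $|S|,|W-S|\ge k$; a cyclic $k$-separation if $\lambda(S)<k$ and $S,W-S$ are both dependent. $\tau(M)$ is the least $k$ with an ordinary $k$-separation ($\infty$ if none); $\kappa^*(M)=\min(\{k\mid\text{cyclic }k\text{ -separation exists}\}\cup\{|W|-r(M)\})$. $M$ is 3-connected if $\tau(M)\ge3$ and cyclically 3-connected if $\kappa^*(M)\ge3$. -}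

module Defs where

open import Data.Bool using (Bool; true; false; _∧_; _∨_; not; _xor_; if_then_else_)
open import Data.Nat using (ℕ; zero; suc; _+_; _<_; _≤_; _⊔_)
open import Data.Fin using (Fin; splitAt) renaming (zero to Fz; suc to Fs)
open import Data.Fin.Properties using (_≟_)
open import Data.Fin.Subset using (Subset; ⊤; ∁; ∣_∣; _⊂_)
open import Data.Vec using (Vec; []; _∷_; replicate; tabulate; zipWith)
open import Data.List using (List; _∷_; []; map; _++_; foldr)
open import Data.Sum using (_⊎_; inj₁; inj₂)
open import Data.Product using (Σ; _×_; ∃; ∃-syntax)
open import Relation.Nullary using (¬_)
open import Relation.Nullary.Decidable using (⌊_⌋)
open import Relation.Binary.PropositionalEquality using (_≡_; _≢_)
open import Relation.Binary.Construct.Closure.ReflexiveTransitive using (Star)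
open import Function.Bundles using (_⇔_)

-- Graphs: finite looped simple graphs on vertex set Fin n.
-- adj u v = true iff uv is an edge; adj v v = true iff v is looped.

record Graph (n : ℕ) : Set where
  field
    adj : Fin n → Fin n → Bool
    sym : ∀ u v → adj u v ≡ adj v u
open Graph public

Nbr : ∀ {n} → Graph n → Fin n → Fin n → Set
Nbr G v w = (w ≢ v) × (adj G v w ≡ true)

Connected : ∀ {n} → Graph n → Set
Connected G = ∀ u v → Star (Nbr G) u v

Twins : ∀ {n} → Graph n → Fin n → Fin n → Set
Twins G v w = (v ≢ w) × (∀ x → ((Nbr G v x × x ≢ w) ⇔ (Nbr G w x × x ≢ v)))

Pendant : ∀ {n} → Graph n → Fin n → Set
Pendant G v = ∃[ w ] (∀ x → (Nbr G v x ⇔ (x ≡ w)))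

-- Binary matroids represented by a GF(2)-matrix with columns Fin m → Vec Bool r
-- (GF(2) = Bool with xor as addition).

Columns : ℕ → ℕ → Set
Columns r m = Fin m → Vec Bool r

allSubsets : (m : ℕ) → List (Subset m)
allSubsets zero = [] ∷ []
allSubsets (suc m) = map (false ∷_) (allSubsets m) ++ map (true ∷_) (allSubsets m)

zeroVec : ∀ {r} → Vec Bool r
zeroVec = replicate _ false

colSum : ∀ {r m} → Columns r m → Subset m → Vec Bool r
colSum {m = zero} c [] = zeroVec
colSum {m = suc m} c (b ∷ U) =
  zipWith _xor_ (if b then c Fz else zeroVec) (colSum (λ i → c (Fs i)) U)


isZero : ∀ {r} → Vec Bool r → Bool
isZero [] = true
isZero (b ∷ v) = not b ∧ isZero v

nonempty? : ∀ {m} → Subset m → Bool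
nonempty? [] = false
nonempty? (b ∷ U) = b ∨ nonempty? U

subset? : ∀ {m} → Subset m → Subset m → Bool
subset? [] [] = true
subset? (a ∷ U) (b ∷ T) = (not a ∨ b) ∧ subset? U T

allL : ∀ {A : Set} → (A → Bool) → List A → Bool
allL p [] = true
allL p (x ∷ xs) = p x ∧ allL p xs

independent? : ∀ {r m} → Columns r m → Subset m → Bool
independent? {m = m} c T =
  allL (λ U → not (subset? U T ∧ (nonempty? U ∧ isZero (colSum c U)))) (allSubsets m)

Independent : ∀ {r m} → Columns r m → Subset m → Set
Independent c T = independent? c T ≡ true

Dependent : ∀ {r m} → Columns r m → Subset m → Set
Dependent c T = ¬ Independent c T

rank : ∀ {r m} → Columns r m → Subset m → ℕ
rank {m = m} c S =
  foldr _⊔_ 0 (map (λ T → if subset? T S ∧ independent? c T then ∣ T ∣ else 0) (allSubsets m))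

-- λ(S) < k, i.e. r(S) + r(W - S) - r(M) < k
ConnLess : ∀ {r m} → Columns r m → Subset m → ℕ → Set
ConnLess c S k = rank c S + rank c (∁ S) < k + rank c ⊤

OrdinarySep : ∀ {r m} → Columns r m → ℕ → Subset m → Set
OrdinarySep c k S = ConnLess c S k × k ≤ ∣ S ∣ × k ≤ ∣ ∁ S ∣

CyclicSep : ∀ {r m} → Columns r m → ℕ → Subset m → Set
CyclicSep c k S = ConnLess c S k × Dependent c S × Dependent c (∁ S)

ThreeConnected : ∀ {r m} → Columns r m → Set
ThreeConnected c = ∀ k S → k < 3 → ¬ OrdinarySep c k S

CyclicallyThreeConnected : ∀ {r m} → Columns r m → Set
CyclicallyThreeConnected {m = m} c =
  (∀ k S → k < 3 → ¬ CyclicSep c k S) × (3 + rank c ⊤ ≤ m)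

Circuit : ∀ {r m} → Columns r m → Subset m → Set
Circuit c C = Dependent c C × (∀ T → T ⊂ C → Independent c T)

HasCircuitOfSize2 : ∀ {r m} → Columns r m → Set
HasCircuitOfSize2 c = ∃[ C ] (Circuit c C × ∣ C ∣ ≡ 2)

-- M[IAS(G)]: columns of (I  A(G)  A(G)+I), ground set Fin (n + (n + n)).

IAS : ∀ {n} → Graph n → Columns n (n + (n + n))
IAS {n} G j with splitAt n j
... | inj₁ v = tabulate (λ u → ⌊ u ≟ v ⌋)
... | inj₂ j' with splitAt n j'
...   | inj₁ v = tabulate (λ u → adj G u v)
...   | inj₂ v = tabulate (λ u → adj G u v xor ⌊ u ≟ v ⌋)

-- All four are equivalent to: M has a parallel pair (two distinct elements with
-- equal columns).  For a partition (S, ∁S) let X be the vertices with two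
--   columns in S; an edge of G leaving X forces r(S) + r(∁S) ≥ r(M) + 2, and if X or
--   ∁X is empty one side has full rank, so without parallel pairs M has no small
--   separation; and equal columns of M are exactly pendant vertices and twins of G.

module Submission where

open import Defs
open import Data.Bool using (Bool; true; false; _∧_; _∨_; not; _xor_; if_then_else_)
open import Data.Bool.Properties
  using (_≟_; xor-same; xor-assoc; xor-comm; xor-identityˡ; xor-identityʳ; ∧-identityʳ; ∧-zeroʳ; ¬-not)
open import Data.Nat using (ℕ; zero; suc; _+_; _∸_; _^_; _<_; _≤_; _⊔_; z≤n; s≤s; _≤?_)
open import Data.Nat.Properties
  using ( ≤-trans; ≤-reflexive; ≤-pred; ≰⇒>; <⇒≱; m≤m⊔n; m≤n⊔m; ⊔-sel; ^-monoʳ-<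
        ; +-mono-≤; +-monoʳ-≤; ∸-monoˡ-≤; +-comm; +-suc; m+[n∸m]≡n; module ≤-Reasoning )
open import Data.Fin using (Fin; zero; suc; funToFin; finToFun; combine; splitAt; join; _↑ˡ_; _↑ʳ_)
  renaming (_≟_ to _≟ᶠ_)
open import Data.Fin.Properties
  using (injective⇒≤; funToFin-finToFin; finToFun-funToFin; suc-injective; any?
        ; splitAt-↑ˡ; splitAt-↑ʳ; join-splitAt; ↑ˡ-injective; ↑ʳ-injective)
open import Data.Fin.Subset
  using (Subset; ⊤; ⊥; ∁; ∣_∣; _⊂_; _⊆_; _∈_; _∉_; ⁅_⁆; Nonempty; _∪_)
open import Data.Fin.Subset.Properties
  using ( ∣⊤∣≡n; _∈?_; _⊆?_; anySubset?; ⊥⊆; ∉⊥; ∣⊥∣≡0; x∈⁅x⁆; x∈⁅y⁆⇒x≡y; ∣⁅x⁆∣≡1; ⊆-antisym; drop-there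
        ; p⊆q⇒∣p∣≤∣q∣; p⊂q⇒∣p∣<∣q∣; Empty-unique; x∈p∪q⁺; x∈p∪q⁻; x≢y⇒x∉⁅y⁆; ⊆⊤; ∣∁p∣≡n∸∣p∣
        ; ∣p∣≤n; x∉p⇒x∈∁p; x∈p⇒x∉∁p; x∈∁p⇒x∉p )
open import Data.Vec using (Vec; []; _∷_; here; there; lookup; tabulate; zipWith; _++_)
open import Data.Vec.Properties
  using ( zipWith-assoc; zipWith-comm; zipWith-identityˡ; zipWith-identityʳ; lookup-zipWith
        ; lookup-replicate; tabulate∘lookup; tabulate-cong; lookup∘tabulate
        ; []=⇒lookup; lookup⇒[]=; ≡-dec; lookup-++ˡ; lookup-++ʳ; lookup-map )
open import Data.List using (List; []; _∷_; map; foldr)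
import Data.List.Membership.Propositional as List
open import Data.List.Membership.Propositional.Properties using (∈-map⁺; ∈-++⁺ˡ; ∈-++⁺ʳ)
open import Data.List.Relation.Unary.Any using (here; there)
open import Data.Product using (_×_; ∃-syntax; _,_; proj₁; proj₂)
open import Data.Sum using (_⊎_; inj₁; inj₂; [_,_]′)
open import Data.Empty using (⊥-elim)
open import Function using (_∘_)
open import Relation.Binary.Construct.Closure.ReflexiveTransitive using (Star; ε; _◅_)
open import Function.Bundles using (_⇔_; mk⇔; Equivalence)
open import Relation.Nullary using (¬_; ¬?; Dec; yes; no; contradiction; _×-dec_)
open import Relation.Nullary.Decidable using (⌊_⌋)
import Relation.Binary.PropositionalEquality as ≡
open ≡ using (_≡_; _≢_; refl; trans; cong; cong₂; subst; module ≡-Reasoning)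

-- Addition in GF(2)^r; on subsets (Subset m = Vec Bool m) it is the
-- symmetric difference.
infixl 6 _⊕_
_⊕_ : ∀ {r} → Vec Bool r → Vec Bool r → Vec Bool r
_⊕_ = zipWith _xor_

⊕-self : ∀ {r} (v : Vec Bool r) → v ⊕ v ≡ zeroVec
⊕-self []      = refl
⊕-self (x ∷ v) = cong₂ _∷_ (xor-same x) (⊕-self v)

module _ {r : ℕ} where

  ⊕-identityˡ : (v : Vec Bool r) → zeroVec ⊕ v ≡ v
  ⊕-identityˡ = zipWith-identityˡ xor-identityˡ

  ⊕-identityʳ : (v : Vec Bool r) → v ⊕ zeroVec ≡ v
  ⊕-identityʳ = zipWith-identityʳ xor-identityʳ

  ⊕-assoc : (u v w : Vec Bool r) → (u ⊕ v) ⊕ w ≡ u ⊕ (v ⊕ w)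
  ⊕-assoc = zipWith-assoc xor-assoc

  ⊕-comm : (u v : Vec Bool r) → u ⊕ v ≡ v ⊕ u
  ⊕-comm = zipWith-comm xor-comm

  -- Every vector is its own negative, so equations are solved by adding.
  ⊕-moveˡ : (x y z : Vec Bool r) → x ⊕ y ≡ z → y ≡ x ⊕ z
  ⊕-moveˡ x y z x⊕y≡z = begin
    y                ≡⟨ ≡.sym (⊕-identityˡ y) ⟩
    zeroVec ⊕ y      ≡⟨ cong (_⊕ y) (≡.sym (⊕-self x)) ⟩
    (x ⊕ x) ⊕ y      ≡⟨ ⊕-assoc x x y ⟩
    x ⊕ (x ⊕ y)      ≡⟨ cong (x ⊕_) x⊕y≡z ⟩
    x ⊕ z            ∎
    where open ≡-Reasoning

  ⊕-cancel : (u v : Vec Bool r) → u ⊕ v ≡ zeroVec → u ≡ v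
  ⊕-cancel u v u⊕v≡0 = ≡.sym (trans (⊕-moveˡ u v zeroVec u⊕v≡0) (⊕-identityʳ u))

  ⊕-interchange : (a b c d : Vec Bool r) → (a ⊕ b) ⊕ (c ⊕ d) ≡ (a ⊕ c) ⊕ (b ⊕ d)
  ⊕-interchange a b c d = begin
    (a ⊕ b) ⊕ (c ⊕ d)  ≡⟨ ⊕-assoc a b (c ⊕ d) ⟩
    a ⊕ (b ⊕ (c ⊕ d))  ≡⟨ cong (a ⊕_) (≡.sym (⊕-assoc b c d)) ⟩
    a ⊕ ((b ⊕ c) ⊕ d)  ≡⟨ cong (λ x → a ⊕ (x ⊕ d)) (⊕-comm b c) ⟩
    a ⊕ ((c ⊕ b) ⊕ d)  ≡⟨ cong (a ⊕_) (⊕-assoc c b d) ⟩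
    a ⊕ (c ⊕ (b ⊕ d))  ≡⟨ ≡.sym (⊕-assoc a c (b ⊕ d)) ⟩
    (a ⊕ c) ⊕ (b ⊕ d)  ∎
    where open ≡-Reasoning

  lookup-⊕ : (u v : Vec Bool r) (i : Fin r) → lookup (u ⊕ v) i ≡ lookup u i xor lookup v i
  lookup-⊕ u v i = lookup-zipWith _xor_ i u v

  lookup-zeroVec : (i : Fin r) → lookup (zeroVec {r}) i ≡ false
  lookup-zeroVec i = lookup-replicate i false

vec-ext : ∀ {A : Set} {k} {u v : Vec A k} → (∀ i → lookup u i ≡ lookup v i) → u ≡ v
vec-ext {u = u} {v} h = trans (≡.sym (tabulate∘lookup u)) (trans (tabulate-cong h) (tabulate∘lookup v))

nonzero-at : ∀ {r} {v : Vec Bool r} i → lookup v i ≡ true → v ≢ zeroVec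
nonzero-at i vᵢ≡true refl with trans (≡.sym (lookup-zeroVec i)) vᵢ≡true
... | ()

∈⇒lookup : ∀ {m} {x : Fin m} {p : Subset m} → x ∈ p → lookup p x ≡ true
∈⇒lookup = []=⇒lookup

lookup⇒∈ : ∀ {m} {x : Fin m} {p : Subset m} → lookup p x ≡ true → x ∈ p
lookup⇒∈ {x = x} {p} = lookup⇒[]= x p

∉⇒lookup : ∀ {m} {x : Fin m} {p : Subset m} → x ∉ p → lookup p x ≡ false
∉⇒lookup {x = x} {p} x∉p with lookup p x in e
... | true  = contradiction (lookup⇒∈ e) x∉p
... | false = refl

∈-⊕ : ∀ {m} (U V : Subset m) {x} → x ∈ U ⊕ V → (x ∈ U × x ∉ V) ⊎ (x ∉ U × x ∈ V)
∈-⊕ (true ∷ U)  (false ∷ V) here = inj₁ (here , λ ())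
∈-⊕ (false ∷ U) (true ∷ V)  here = inj₂ ((λ ()) , here)
∈-⊕ (a ∷ U)     (b ∷ V)     (there x∈) with ∈-⊕ U V x∈
... | inj₁ (p , q) = inj₁ (there p , q ∘ drop-there)
... | inj₂ (p , q) = inj₂ (p ∘ drop-there , there q)

⊆-≡-by-size : ∀ {m} {p q : Subset m} → p ⊆ q → ∣ q ∣ ≤ ∣ p ∣ → p ≡ q
⊆-≡-by-size {p = p} {q} p⊆q ∣q∣≤∣p∣ = ⊆-antisym p⊆q q⊆p
  where
  q⊆p : q ⊆ p
  q⊆p {x} x∈q with x ∈? p
  ... | yes x∈p = x∈p
  ... | no  x∉p = contradiction ∣q∣≤∣p∣ (<⇒≱ (p⊂q⇒∣p∣<∣q∣ (p⊆q , x , x∈q , x∉p)))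

pick-one : ∀ {m} (S : Subset m) → 1 ≤ ∣ S ∣ → ∃[ j ] j ∈ S
pick-one (true ∷ S)  _ = zero , here
pick-one (false ∷ S) h with pick-one S h
... | j , j∈ = suc j , there j∈

pick-two : ∀ {m} (S : Subset m) → 2 ≤ ∣ S ∣ → ∃[ j ] ∃[ j' ] (j ≢ j' × j ∈ S × j' ∈ S)
pick-two (true ∷ S)  (s≤s h) with pick-one S h
... | j , j∈ = zero , suc j , (λ ()) , here , there j∈
pick-two (false ∷ S) h with pick-two S h
... | j , j' , j≢j' , j∈ , j'∈ = suc j , suc j' , j≢j' ∘ suc-injective , there j∈ , there j'∈

pair : ∀ {m} → Fin m → Fin m → Subset m
pair j j' = ⁅ j ⁆ ⊕ ⁅ j' ⁆

module _ {m : ℕ} {j j' : Fin m} where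

  pair-members : ∀ {x} → x ∈ pair j j' → x ≡ j ⊎ x ≡ j'
  pair-members x∈ with ∈-⊕ ⁅ j ⁆ ⁅ j' ⁆ x∈
  ... | inj₁ (x∈⁅j⁆ , _) = inj₁ (x∈⁅y⁆⇒x≡y j x∈⁅j⁆)
  ... | inj₂ (_ , x∈⁅j'⁆) = inj₂ (x∈⁅y⁆⇒x≡y j' x∈⁅j'⁆)

  pair-⊆ : ∀ {S} → j ∈ S → j' ∈ S → pair j j' ⊆ S
  pair-⊆ j∈ j'∈ x∈ = [ (λ { refl → j∈ }) , (λ { refl → j'∈ }) ]′ (pair-members x∈)

  ∣pair∣≡2 : j ≢ j' → ∣ pair j j' ∣ ≡ 2
  ∣pair∣≡2 j≢j' = trans (size ⁅ j ⁆ j' j'∉⁅j⁆) (cong suc (∣⁅x⁆∣≡1 j))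
    where
    j'∉⁅j⁆ : j' ∉ ⁅ j ⁆
    j'∉⁅j⁆ j'∈ = j≢j' (≡.sym (x∈⁅y⁆⇒x≡y j j'∈))
    size : ∀ {k} (p : Subset k) x → x ∉ p → ∣ p ⊕ ⁅ x ⁆ ∣ ≡ suc ∣ p ∣
    size (true ∷ p)  zero    x∉ = contradiction here x∉
    size (false ∷ p) zero    x∉ = cong (suc ∘ ∣_∣) (⊕-identityʳ p)
    size (true ∷ p)  (suc x) x∉ = cong suc (size p x (x∉ ∘ there))
    size (false ∷ p) (suc x) x∉ = size p x (x∉ ∘ there)

  pair-∈ˡ : j ≢ j' → j ∈ pair j j'
  pair-∈ˡ j≢j' = lookup⇒∈ (trans (lookup-⊕ ⁅ j ⁆ ⁅ j' ⁆ j)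
                   (cong₂ _xor_ (∈⇒lookup (x∈⁅x⁆ j)) (∉⇒lookup (x≢y⇒x∉⁅y⁆ j≢j'))))

  pair-≡ : ∀ {C} → j ≢ j' → j ∈ C → j' ∈ C → ∣ C ∣ ≡ 2 → pair j j' ≡ C
  pair-≡ j≢j' j∈ j'∈ ∣C∣≡2 =
    ⊆-≡-by-size (pair-⊆ j∈ j'∈) (≤-reflexive (trans ∣C∣≡2 (≡.sym (∣pair∣≡2 j≢j'))))

-- Counting: there is no injection from Subset a into Subset b when b < a.
-- Subsets of Fin k are encoded as functions Fin k → Fin 2, counted by 2 ^ k.
module SubsetCounting where

  bit : Bool → Fin 2
  bit false = zero
  bit true  = suc zero

  unbit : Fin 2 → Bool
  unbit zero       = false
  unbit (suc zero) = true

  unbit-bit : ∀ b → unbit (bit b) ≡ b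
  unbit-bit false = refl
  unbit-bit true  = refl

  bit-unbit : ∀ x → bit (unbit x) ≡ x
  bit-unbit zero       = refl
  bit-unbit (suc zero) = refl

  encode : ∀ {k} → Subset k → Fin (2 ^ k)
  encode U = funToFin (bit ∘ lookup U)

  decode : ∀ {k} → Fin (2 ^ k) → Subset k
  decode x = tabulate (unbit ∘ finToFun x)

  funToFin-cong : ∀ {k} {f g : Fin k → Fin 2} → (∀ i → f i ≡ g i) → funToFin f ≡ funToFin g
  funToFin-cong {zero}  _ = refl
  funToFin-cong {suc k} h = cong₂ combine (h zero) (funToFin-cong (h ∘ suc))

  encode-injective : ∀ {k} {U V : Subset k} → encode U ≡ encode V → U ≡ V
  encode-injective {U = U} {V} e = vec-ext λ i → begin
    lookup U i                              ≡⟨ ≡.sym (unbit-bit _) ⟩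
    unbit (bit (lookup U i))                ≡⟨ cong unbit (≡.sym (finToFun-funToFin (bit ∘ lookup U) i)) ⟩
    unbit (finToFun (encode U) i)           ≡⟨ cong (λ x → unbit (finToFun x i)) e ⟩
    unbit (finToFun (encode V) i)           ≡⟨ cong unbit (finToFun-funToFin (bit ∘ lookup V) i) ⟩
    unbit (bit (lookup V i))                ≡⟨ unbit-bit _ ⟩
    lookup V i                              ∎
    where open ≡-Reasoning

  decode-injective : ∀ {k} {x y : Fin (2 ^ k)} → decode {k} x ≡ decode y → x ≡ y
  decode-injective {k} {x} {y} e =
    trans (≡.sym (funToFin-finToFin {k} {2} x))
      (trans (funToFin-cong same-bits) (funToFin-finToFin {k} {2} y))
    where
    same-bits : ∀ i → finToFun x i ≡ finToFun y i
    same-bits i = begin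
      finToFun x i                  ≡⟨ ≡.sym (bit-unbit _) ⟩
      bit (unbit (finToFun x i))    ≡⟨ cong bit (≡.sym (lookup∘tabulate _ i)) ⟩
      bit (lookup (decode x) i)     ≡⟨ cong (λ U → bit (lookup U i)) e ⟩
      bit (lookup (decode y) i)     ≡⟨ cong bit (lookup∘tabulate _ i) ⟩
      bit (unbit (finToFun y i))    ≡⟨ bit-unbit _ ⟩
      finToFun y i                  ∎
      where open ≡-Reasoning

  2^-cancel-≤ : ∀ a b → 2 ^ a ≤ 2 ^ b → a ≤ b
  2^-cancel-≤ a b h with a ≤? b
  ... | yes a≤b = a≤b
  ... | no  a≰b = contradiction h (<⇒≱ (^-monoʳ-< 2 (s≤s (s≤s z≤n)) (≰⇒> a≰b)))

  subset-injection⇒≤ : ∀ {a b} (f : Subset a → Subset b) →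
    (∀ {U V} → f U ≡ f V → U ≡ V) → a ≤ b
  subset-injection⇒≤ {a} {b} f f-inj =
    2^-cancel-≤ a b (injective⇒≤ {f = encode ∘ f ∘ decode}
      (decode-injective ∘ f-inj ∘ encode-injective))

open SubsetCounting using (subset-injection⇒≤)

colSum-⊥ : ∀ {r m} (c : Columns r m) → colSum c ⊥ ≡ zeroVec
colSum-⊥ {m = zero}  c = refl
colSum-⊥ {m = suc m} c = trans (⊕-identityˡ _) (colSum-⊥ (c ∘ suc))

if-xor : ∀ {r} (a b : Bool) (v : Vec Bool r) →
  (if a xor b then v else zeroVec) ≡ (if a then v else zeroVec) ⊕ (if b then v else zeroVec)
if-xor false false v = ≡.sym (⊕-identityˡ zeroVec)
if-xor false true  v = ≡.sym (⊕-identityˡ v)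
if-xor true  false v = ≡.sym (⊕-identityʳ v)
if-xor true  true  v = ≡.sym (⊕-self v)

colSum-⊕ : ∀ {r m} (c : Columns r m) (U V : Subset m) → colSum c (U ⊕ V) ≡ colSum c U ⊕ colSum c V
colSum-⊕ {m = zero}  c [] [] = ≡.sym (⊕-identityˡ zeroVec)
colSum-⊕ {m = suc m} c (a ∷ U) (b ∷ V) =
  trans (cong₂ _⊕_ (if-xor a b (c zero)) (colSum-⊕ (c ∘ suc) U V)) (⊕-interchange _ _ _ _)

colSum-⁅⁆ : ∀ {r m} (c : Columns r m) (j : Fin m) → colSum c ⁅ j ⁆ ≡ c j
colSum-⁅⁆ {m = suc m} c zero    = trans (cong (c zero ⊕_) (colSum-⊥ (c ∘ suc))) (⊕-identityʳ _)
colSum-⁅⁆ {m = suc m} c (suc j) = trans (⊕-identityˡ _) (colSum-⁅⁆ (c ∘ suc) j)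

colSum-closed : ∀ {r m} (P : Vec Bool r → Set) → P zeroVec → (∀ u v → P u → P v → P (u ⊕ v)) →
  (c : Columns r m) (U : Subset m) → (∀ j → j ∈ U → P (c j)) → P (colSum c U)
colSum-closed {m = zero}  P P0 P⊕ c []          _ = P0
colSum-closed {m = suc m} P P0 P⊕ c (false ∷ U) h =
  P⊕ _ _ P0 (colSum-closed P P0 P⊕ (c ∘ suc) U (λ j → h (suc j) ∘ there))
colSum-closed {m = suc m} P P0 P⊕ c (true ∷ U)  h =
  P⊕ _ _ (h zero here) (colSum-closed P P0 P⊕ (c ∘ suc) U (λ j → h (suc j) ∘ there))

∧-true⁻ : ∀ {a b} → a ∧ b ≡ true → a ≡ true × b ≡ true
∧-true⁻ {true} b≡true = refl , b≡true

allL-intro : ∀ {A : Set} (p : A → Bool) xs → (∀ x → p x ≡ true) → allL p xs ≡ true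
allL-intro p []       h = refl
allL-intro p (x ∷ xs) h rewrite h x = allL-intro p xs h

allL-elim : ∀ {A : Set} (p : A → Bool) xs → allL p xs ≡ true → ∀ {x} → x List.∈ xs → p x ≡ true
allL-elim p (y ∷ xs) e (here refl) = proj₁ (∧-true⁻ e)
allL-elim p (y ∷ xs) e (there x∈)  = allL-elim p xs (proj₂ (∧-true⁻ {p y} e)) x∈

allSubsets-complete : ∀ {m} (U : Subset m) → U List.∈ allSubsets m
allSubsets-complete []              = here refl
allSubsets-complete {suc m} (false ∷ U) = ∈-++⁺ˡ (∈-map⁺ (false ∷_) (allSubsets-complete U))
allSubsets-complete {suc m} (true ∷ U)  =
  ∈-++⁺ʳ (map (false ∷_) (allSubsets m)) (∈-map⁺ (true ∷_) (allSubsets-complete U))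

subset?-sound : ∀ {m} {U T : Subset m} → subset? U T ≡ true → U ⊆ T
subset?-sound {U = true ∷ U} {true ∷ T}  e here = here
subset?-sound {U = true ∷ U} {false ∷ T} () here
subset?-sound {U = a ∷ U}    {b ∷ T}     e (there x∈) =
  there (subset?-sound (proj₂ (∧-true⁻ {not a ∨ b} e)) x∈)

subset?-complete : ∀ {m} {U T : Subset m} → U ⊆ T → subset? U T ≡ true
subset?-complete {U = []}        {[]}        _ = refl
subset?-complete {U = false ∷ U} {b ∷ T}     h = subset?-complete (drop-there ∘ h ∘ there)
subset?-complete {U = true ∷ U}  {true ∷ T}  h = subset?-complete (drop-there ∘ h ∘ there)
subset?-complete {U = true ∷ U}  {false ∷ T} h with h here
... | ()

nonempty?-sound : ∀ {m} {U : Subset m} → nonempty? U ≡ true → Nonempty U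
nonempty?-sound {U = true ∷ U}  _ = zero , here
nonempty?-sound {U = false ∷ U} e with nonempty?-sound e
... | x , x∈ = suc x , there x∈

nonempty?-complete : ∀ {m} {U : Subset m} → Nonempty U → nonempty? U ≡ true
nonempty?-complete {U = true ∷ U}  _                  = refl
nonempty?-complete {U = false ∷ U} (suc x , there x∈) = nonempty?-complete (x , x∈)

isZero-sound : ∀ {r} {v : Vec Bool r} → isZero v ≡ true → v ≡ zeroVec
isZero-sound {v = []}        _ = refl
isZero-sound {v = false ∷ v} e = cong (false ∷_) (isZero-sound e)

isZero-zeroVec : ∀ {r} → isZero (zeroVec {r}) ≡ true
isZero-zeroVec {zero}  = refl
isZero-zeroVec {suc r} = isZero-zeroVec {r}

module _ {A : Set} (g : A → ℕ) where

  max : List A → ℕ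
  max xs = foldr _⊔_ 0 (map g xs)

  ≤-max : ∀ xs {x} → x List.∈ xs → g x ≤ max xs
  ≤-max (y ∷ xs) (here refl) = m≤m⊔n _ _
  ≤-max (y ∷ xs) (there x∈)  = ≤-trans (≤-max xs x∈) (m≤n⊔m (g y) _)

  max-attained : ∀ xs → max xs ≡ 0 ⊎ ∃[ x ] (x List.∈ xs × max xs ≡ g x)
  max-attained []       = inj₁ refl
  max-attained (y ∷ xs) with ⊔-sel (g y) (max xs)
  ... | inj₁ e = inj₂ (y , here refl , e)
  ... | inj₂ e with max-attained xs
  ...   | inj₁ e'            = inj₁ (trans e e')
  ...   | inj₂ (x , x∈ , e') = inj₂ (x , there x∈ , trans e e')

-- Independence, rank and span in the matroid of a GF(2)-matrix

module _ {r m : ℕ} (c : Columns r m) where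

  independent-intro : ∀ T → (∀ U → U ⊆ T → Nonempty U → colSum c U ≢ zeroVec) → Independent c T
  independent-intro T h = allL-intro _ (allSubsets m) no-zero-sum
    where
    no-zero-sum : ∀ U → not (subset? U T ∧ (nonempty? U ∧ isZero (colSum c U))) ≡ true
    no-zero-sum U with subset? U T in e₁ | nonempty? U in e₂ | isZero (colSum c U) in e₃
    ... | false | _     | _     = refl
    ... | true  | false | _     = refl
    ... | true  | true  | false = refl
    ... | true  | true  | true  =
      ⊥-elim (h U (subset?-sound e₁) (nonempty?-sound e₂) (isZero-sound e₃))

  independent-elim : ∀ T → Independent c T → ∀ U → U ⊆ T → Nonempty U → colSum c U ≢ zeroVec
  independent-elim T ind U U⊆T ne sum≡0 =
    contradiction (trans (≡.sym verdict) (allL-elim _ (allSubsets m) ind (allSubsets-complete U))) λ ()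
    where
    verdict : not (subset? U T ∧ (nonempty? U ∧ isZero (colSum c U))) ≡ false
    verdict rewrite subset?-complete U⊆T | nonempty?-complete ne | sum≡0 | isZero-zeroVec {r} = refl

  ⊥-independent : Independent c ⊥
  ⊥-independent = independent-intro ⊥ (λ U U⊆⊥ (x , x∈) _ → ∉⊥ (U⊆⊥ x∈))

  zero-entry : ∀ U i → (∀ j → j ∈ U → lookup (c j) i ≡ false) → lookup (colSum c U) i ≡ false
  zero-entry U i = colSum-closed (λ v → lookup v i ≡ false) (lookup-zeroVec i)
                     (λ u v uᵢ vᵢ → trans (lookup-⊕ u v i) (cong₂ _xor_ uᵢ vᵢ)) c U

  pivot-entry : ∀ U j i → j ∈ U → lookup (c j) i ≡ true →
    (∀ j' → j' ∈ U → j' ≢ j → lookup (c j') i ≡ false) → lookup (colSum c U) i ≡ true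
  pivot-entry U j i j∈U cⱼᵢ others = begin
    lookup (colSum c U) i
      ≡⟨ cong (λ W → lookup (colSum c W) i) split ⟩
    lookup (colSum c (⁅ j ⁆ ⊕ (U ⊕ ⁅ j ⁆))) i
      ≡⟨ cong (λ v → lookup v i) (colSum-⊕ c ⁅ j ⁆ (U ⊕ ⁅ j ⁆)) ⟩
    lookup (colSum c ⁅ j ⁆ ⊕ colSum c (U ⊕ ⁅ j ⁆)) i
      ≡⟨ lookup-⊕ (colSum c ⁅ j ⁆) _ i ⟩
    lookup (colSum c ⁅ j ⁆) i xor lookup (colSum c (U ⊕ ⁅ j ⁆)) i
      ≡⟨ cong₂ _xor_ pivot (zero-entry _ i other) ⟩
    true
      ∎
    where
    open ≡-Reasoning
    split : U ≡ ⁅ j ⁆ ⊕ (U ⊕ ⁅ j ⁆)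
    split = ⊕-moveˡ ⁅ j ⁆ U _ (⊕-comm ⁅ j ⁆ U)
    pivot : lookup (colSum c ⁅ j ⁆) i ≡ true
    pivot = trans (cong (λ v → lookup v i) (colSum-⁅⁆ c j)) cⱼᵢ
    other : ∀ j' → j' ∈ U ⊕ ⁅ j ⁆ → lookup (c j') i ≡ false
    other j' j'∈ with ∈-⊕ U ⁅ j ⁆ j'∈
    ... | inj₁ (j'∈U , j'∉⁅j⁆) = others j' j'∈U (λ { refl → j'∉⁅j⁆ (x∈⁅x⁆ j) })
    ... | inj₂ (j'∉U , j'∈⁅j⁆) = contradiction (subst (_∈ U) (≡.sym (x∈⁅y⁆⇒x≡y j j'∈⁅j⁆)) j∈U) j'∉U

  candidate : Subset m → Subset m → ℕ
  candidate S T = if subset? T S ∧ independent? c T then ∣ T ∣ else 0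

  rank-≥ : ∀ S T → T ⊆ S → Independent c T → ∣ T ∣ ≤ rank c S
  rank-≥ S T T⊆S ind = subst (_≤ rank c S) value (≤-max (candidate S) (allSubsets m) (allSubsets-complete T))
    where
    value : candidate S T ≡ ∣ T ∣
    value rewrite subset?-complete T⊆S | ind = refl

  empty-basis : ∀ S → rank c S ≡ 0 → ∃[ B ] (B ⊆ S × Independent c B × rank c S ≡ ∣ B ∣)
  empty-basis S rank≡0 = ⊥ , ⊥⊆ , ⊥-independent , trans rank≡0 (≡.sym (∣⊥∣≡0 m))

  rank-attained : ∀ S → ∃[ B ] (B ⊆ S × Independent c B × rank c S ≡ ∣ B ∣)
  rank-attained S with max-attained (candidate S) (allSubsets m)
  ... | inj₁ rank≡0 = empty-basis S rank≡0
  ... | inj₂ (T , _ , rank≡) with subset? T S in e₁ | independent? c T in e₂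
  ...   | true  | true  = T , subset?-sound e₁ , e₂ , rank≡
  ...   | true  | false = empty-basis S rank≡
  ...   | false | _     = empty-basis S rank≡

  rank-≤ : ∀ S k → (∀ T → T ⊆ S → Independent c T → ∣ T ∣ ≤ k) → rank c S ≤ k
  rank-≤ S k h with rank-attained S
  ... | B , B⊆S , ind , rank≡ = subst (_≤ k) (≡.sym rank≡) (h B B⊆S ind)

  rank-mono : ∀ {S S'} → S ⊆ S' → rank c S ≤ rank c S'
  rank-mono {S} {S'} S⊆S' = rank-≤ S _ (λ T T⊆S → rank-≥ S' T (S⊆S' ∘ T⊆S))

  InSpan : Subset m → Vec Bool r → Set
  InSpan S v = ∃[ U ] (U ⊆ S × colSum c U ≡ v)

  span? : ∀ S v → Dec (InSpan S v)
  span? S v = anySubset? (λ U → (U ⊆? S) ×-dec ≡-dec _≟_ (colSum c U) v)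

  span-col : ∀ {S} j → j ∈ S → InSpan S (c j)
  span-col {S} j j∈S = ⁅ j ⁆ , (λ x∈ → subst (_∈ S) (≡.sym (x∈⁅y⁆⇒x≡y j x∈)) j∈S) , colSum-⁅⁆ c j

  span-⊕ : ∀ {S u v} → InSpan S u → InSpan S v → InSpan S (u ⊕ v)
  span-⊕ (U , U⊆S , ΣU) (V , V⊆S , ΣV) =
    U ⊕ V , (λ x∈ → [ U⊆S ∘ proj₁ , V⊆S ∘ proj₂ ]′ (∈-⊕ U V x∈)) , trans (colSum-⊕ c U V) (cong₂ _⊕_ ΣU ΣV)

  span-sum : ∀ {S} U → (∀ j → j ∈ U → InSpan S (c j)) → InSpan S (colSum c U)
  span-sum {S} U = colSum-closed (InSpan S) (⊥ , ⊥⊆ , colSum-⊥ c) (λ _ _ → span-⊕) c U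

expand : ∀ {m} (I : Subset m) → Subset ∣ I ∣ → Subset m
expand []          W       = []
expand (false ∷ I) W       = false ∷ expand I W
expand (true ∷ I)  (w ∷ W) = w ∷ expand I W

compress : ∀ {m} (I : Subset m) → Subset m → Subset ∣ I ∣
compress []          []      = []
compress (false ∷ I) (_ ∷ U) = compress I U
compress (true ∷ I)  (u ∷ U) = u ∷ compress I U

expand-⊆ : ∀ {m} (I : Subset m) W → expand I W ⊆ I
expand-⊆ (false ∷ I) W       (there x∈) = there (expand-⊆ I W x∈)
expand-⊆ (true ∷ I)  (w ∷ W) here       = here
expand-⊆ (true ∷ I)  (w ∷ W) (there x∈) = there (expand-⊆ I W x∈)

compress-expand : ∀ {m} (I : Subset m) W → compress I (expand I W) ≡ W
compress-expand []          []      = refl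
compress-expand (false ∷ I) W       = compress-expand I W
compress-expand (true ∷ I)  (w ∷ W) = cong (w ∷_) (compress-expand I W)

expand-compress : ∀ {m} (I U : Subset m) → U ⊆ I → expand I (compress I U) ≡ U
expand-compress []          []          _   = refl
expand-compress (false ∷ I) (false ∷ U) U⊆I = cong (false ∷_) (expand-compress I U (drop-there ∘ U⊆I ∘ there))
expand-compress (false ∷ I) (true ∷ U)  U⊆I with U⊆I here
... | ()
expand-compress (true ∷ I)  (u ∷ U)     U⊆I = cong (u ∷_) (expand-compress I U (drop-there ∘ U⊆I ∘ there))

module _ {r m : ℕ} (c : Columns r m) where

  -- Each W ⊆ I is sent to some U ⊆ B with the same column sum;
  -- independence of I makes this map injective, so 2^∣ I ∣ ≤ 2^∣ B ∣.
  independent-in-span-≤ : ∀ I B → Independent c I → (∀ j → j ∈ I → InSpan c B (c j)) → ∣ I ∣ ≤ ∣ B ∣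
  independent-in-span-≤ I B ind I⊆span = subset-injection⇒≤ f f-injective
    where
    representation : ∀ W → InSpan c B (colSum c (expand I W))
    representation W = span-sum c (expand I W) (λ j j∈ → I⊆span j (expand-⊆ I W j∈))
    f : Subset ∣ I ∣ → Subset ∣ B ∣
    f W = compress B (proj₁ (representation W))
    f-injective : ∀ {W W'} → f W ≡ f W' → W ≡ W'
    f-injective {W} {W'} fW≡fW' =
      trans (≡.sym (compress-expand I W)) (trans (cong (compress I) same-expansion) (compress-expand I W'))
      where
      U U' : Subset m
      U = proj₁ (representation W)
      U' = proj₁ (representation W')
      U≡U' : U ≡ U'
      U≡U' = trans (≡.sym (expand-compress B U (proj₁ (proj₂ (representation W)))))
               (trans (cong (expand B) fW≡fW') (expand-compress B U' (proj₁ (proj₂ (representation W')))))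
      same-sum : colSum c (expand I W) ≡ colSum c (expand I W')
      same-sum = trans (≡.sym (proj₂ (proj₂ (representation W))))
                   (trans (cong (colSum c) U≡U') (proj₂ (proj₂ (representation W'))))
      D : Subset m
      D = expand I W ⊕ expand I W'
      D-sum : colSum c D ≡ zeroVec
      D-sum = trans (colSum-⊕ c _ _) (trans (cong (_⊕ colSum c (expand I W')) same-sum) (⊕-self _))
      D⊆I : D ⊆ I
      D⊆I x∈ = [ expand-⊆ I W ∘ proj₁ , expand-⊆ I W' ∘ proj₂ ]′ (∈-⊕ _ _ x∈)
      same-expansion : expand I W ≡ expand I W'
      same-expansion = ⊕-cancel _ _ (Empty-unique (λ ne → independent-elim c I ind D D⊆I ne D-sum))

  independent-extend : ∀ B k → Independent c B → ¬ InSpan c B (c k) → Independent c (B ∪ ⁅ k ⁆)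
  independent-extend B k indB k∉span = independent-intro c (B ∪ ⁅ k ⁆) no-zero-sum
    where
    no-zero-sum : ∀ U → U ⊆ B ∪ ⁅ k ⁆ → Nonempty U → colSum c U ≢ zeroVec
    no-zero-sum U U⊆ ne sum≡0 with k ∈? U
    ... | yes k∈U = k∉span (U ⊕ ⁅ k ⁆ , rest⊆B , trans (colSum-⊕ c U ⁅ k ⁆)
                      (trans (cong₂ _⊕_ sum≡0 (colSum-⁅⁆ c k)) (⊕-identityˡ _)))
      where
      rest⊆B : U ⊕ ⁅ k ⁆ ⊆ B
      rest⊆B x∈ with ∈-⊕ U ⁅ k ⁆ x∈
      ... | inj₂ (x∉U , x∈⁅k⁆) = contradiction (subst (_∈ U) (≡.sym (x∈⁅y⁆⇒x≡y k x∈⁅k⁆)) k∈U) x∉U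
      ... | inj₁ (x∈U , x∉⁅k⁆) = [ (λ x∈B → x∈B) , (λ x∈⁅k⁆ → contradiction x∈⁅k⁆ x∉⁅k⁆) ]′
                                   (x∈p∪q⁻ B ⁅ k ⁆ (U⊆ x∈U))
    ... | no k∉U = independent-elim c B indB U U⊆B ne sum≡0
      where
      U⊆B : U ⊆ B
      U⊆B {x} x∈ = [ (λ x∈B → x∈B) , (λ x∈⁅k⁆ → contradiction (subst (_∈ U) (x∈⁅y⁆⇒x≡y k x∈⁅k⁆) x∈) k∉U) ]′
                     (x∈p∪q⁻ B ⁅ k ⁆ (U⊆ x∈))

  basis-spans : ∀ S B → B ⊆ S → Independent c B → rank c S ≡ ∣ B ∣ → ∀ k → k ∈ S → InSpan c B (c k)
  basis-spans S B B⊆S indB rank≡ k k∈S with span? c B (c k)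
  ... | yes in-span = in-span
  ... | no  k∉span  = contradiction (rank-≥ c S (B ∪ ⁅ k ⁆) B∪k⊆S (independent-extend B k indB k∉span))
                        (<⇒≱ (subst (_< ∣ B ∪ ⁅ k ⁆ ∣) (≡.sym rank≡) larger))
    where
    B∪k⊆S : B ∪ ⁅ k ⁆ ⊆ S
    B∪k⊆S x∈ = [ B⊆S , (λ x∈⁅k⁆ → subst (_∈ S) (≡.sym (x∈⁅y⁆⇒x≡y k x∈⁅k⁆)) k∈S) ]′ (x∈p∪q⁻ B ⁅ k ⁆ x∈)
    k∉B : k ∉ B
    k∉B k∈B = k∉span (span-col c k k∈B)
    larger : ∣ B ∣ < ∣ B ∪ ⁅ k ⁆ ∣
    larger = p⊂q⇒∣p∣<∣q∣ (x∈p∪q⁺ ∘ inj₁ , k , x∈p∪q⁺ (inj₂ (x∈⁅x⁆ k)) , k∉B)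

  independent-in-span-≤-rank : ∀ S I → Independent c I → (∀ j → j ∈ I → InSpan c S (c j)) → ∣ I ∣ ≤ rank c S
  independent-in-span-≤-rank S I ind I⊆span with rank-attained c S
  ... | B , B⊆S , indB , rank≡ = subst (∣ I ∣ ≤_) (≡.sym rank≡)
          (independent-in-span-≤ I B ind (λ j j∈ → in-B j (I⊆span j j∈)))
    where
    in-B : ∀ j → InSpan c S (c j) → InSpan c B (c j)
    in-B j (U , U⊆S , ΣU) = subst (InSpan c B) ΣU
      (span-sum c U (λ k k∈ → basis-spans S B B⊆S indB rank≡ k (U⊆S k∈)))

  rank-≤-spanning : ∀ S E → (∀ j → j ∈ S → InSpan c E (c j)) → rank c S ≤ ∣ E ∣
  rank-≤-spanning S E S⊆span =
    rank-≤ c S ∣ E ∣ (λ T T⊆S ind → independent-in-span-≤ T E ind (λ j → S⊆span j ∘ T⊆S))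

-- Loopless binary matroids: parallel pairs versus small separations

module _ {r m : ℕ} (c : Columns r m) where

  Loopless : Set
  Loopless = ∀ j → c j ≢ zeroVec

  ParallelPair : Set
  ParallelPair = ∃[ j ] ∃[ j' ] (j ≢ j' × c j ≡ c j')

  parallel? : Dec ParallelPair
  parallel? = any? λ j → any? λ j' → ¬? (j ≟ᶠ j') ×-dec ≡-dec _≟_ (c j) (c j')

  small-independent : Loopless → ∀ S → ∣ S ∣ ≤ 1 → Independent c S
  small-independent loopless S ∣S∣≤1 = independent-intro c S no-zero-sum
    where
    no-zero-sum : ∀ U → U ⊆ S → Nonempty U → colSum c U ≢ zeroVec
    no-zero-sum U U⊆S (x , x∈U) sum≡0 = loopless x (begin
      c x              ≡⟨ ≡.sym (colSum-⁅⁆ c x) ⟩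
      colSum c ⁅ x ⁆   ≡⟨ cong (colSum c) ⁅x⁆≡U ⟩
      colSum c U       ≡⟨ sum≡0 ⟩
      zeroVec          ∎)
      where
      open ≡-Reasoning
      ⁅x⁆≡U : ⁅ x ⁆ ≡ U
      ⁅x⁆≡U = ⊆-≡-by-size (λ y∈ → subst (_∈ U) (≡.sym (x∈⁅y⁆⇒x≡y x y∈)) x∈U)
                (≤-trans (p⊆q⇒∣p∣≤∣q∣ U⊆S) (subst (∣ S ∣ ≤_) (≡.sym (∣⁅x⁆∣≡1 x)) ∣S∣≤1))

  dependent⇒≥2 : Loopless → ∀ S → Dependent c S → 2 ≤ ∣ S ∣
  dependent⇒≥2 loopless S dep with 2 ≤? ∣ S ∣
  ... | yes 2≤∣S∣ = 2≤∣S∣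
  ... | no  2≰∣S∣ = contradiction (small-independent loopless S (≤-pred (≰⇒> 2≰∣S∣))) dep

  module _ {j j' : Fin m} (j≢j' : j ≢ j') where

    pair-sum : colSum c (pair j j') ≡ c j ⊕ c j'
    pair-sum = trans (colSum-⊕ c ⁅ j ⁆ ⁅ j' ⁆) (cong₂ _⊕_ (colSum-⁅⁆ c j) (colSum-⁅⁆ c j'))

    large-⊆-pair : ∀ {U} → U ⊆ pair j j' → 2 ≤ ∣ U ∣ → U ≡ pair j j'
    large-⊆-pair U⊆ 2≤∣U∣ = ⊆-≡-by-size U⊆ (subst (_≤ _) (≡.sym (∣pair∣≡2 j≢j')) 2≤∣U∣)

    pair-independent : Loopless → c j ≢ c j' → Independent c (pair j j')
    pair-independent loopless cj≢cj' = independent-intro c (pair j j') no-zero-sum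
      where
      no-zero-sum : ∀ U → U ⊆ pair j j' → Nonempty U → colSum c U ≢ zeroVec
      no-zero-sum U U⊆ ne sum≡0 with 2 ≤? ∣ U ∣
      ... | no  2≰∣U∣ = independent-elim c U (small-independent loopless U (≤-pred (≰⇒> 2≰∣U∣)))
                          U (λ x∈ → x∈) ne sum≡0
      ... | yes 2≤∣U∣ = cj≢cj' (⊕-cancel (c j) (c j')
                          (trans (≡.sym pair-sum) (subst (λ W → colSum c W ≡ zeroVec) (large-⊆-pair U⊆ 2≤∣U∣) sum≡0)))

    pair-dependent : c j ≡ c j' → Dependent c (pair j j')
    pair-dependent cj≡cj' ind = independent-elim c (pair j j') ind (pair j j') (λ x∈ → x∈)
      (j , pair-∈ˡ j≢j') (trans pair-sum (trans (cong (_⊕ c j') cj≡cj') (⊕-self (c j'))))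

    pair-rank-≤1 : c j ≡ c j' → rank c (pair j j') ≤ 1
    pair-rank-≤1 cj≡cj' = rank-≤ c (pair j j') 1 small
      where
      small : ∀ T → T ⊆ pair j j' → Independent c T → ∣ T ∣ ≤ 1
      small T T⊆ ind with 2 ≤? ∣ T ∣
      ... | no  2≰∣T∣ = ≤-pred (≰⇒> 2≰∣T∣)
      ... | yes 2≤∣T∣ = contradiction (subst (Independent c) (large-⊆-pair T⊆ 2≤∣T∣) ind) (pair-dependent cj≡cj')

    pair-separation : c j ≡ c j' → ConnLess c (pair j j') 2
    pair-separation cj≡cj' = s≤s (+-mono-≤ (pair-rank-≤1 cj≡cj') (rank-mono c ⊆⊤))

    ∣∁pair∣ : ∣ ∁ (pair j j') ∣ ≡ m ∸ 2
    ∣∁pair∣ = trans (∣∁p∣≡n∸∣p∣ (pair j j')) (cong (m ∸_) (∣pair∣≡2 j≢j'))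

  rank-≥-size : Loopless → ¬ ParallelPair → ∀ S k → k ≤ 2 → k ≤ ∣ S ∣ → k ≤ rank c S
  rank-≥-size loopless simple S zero          _ _ = z≤n
  rank-≥-size loopless simple S (suc zero)    _ 1≤∣S∣ with pick-one S 1≤∣S∣
  ... | j , j∈S = subst (_≤ rank c S) (∣⁅x⁆∣≡1 j)
        (rank-≥ c S ⁅ j ⁆ (λ x∈ → subst (_∈ S) (≡.sym (x∈⁅y⁆⇒x≡y j x∈)) j∈S)
          (small-independent loopless ⁅ j ⁆ (≤-reflexive (∣⁅x⁆∣≡1 j))))
  rank-≥-size loopless simple S (suc (suc zero)) _ 2≤∣S∣ with pick-two S 2≤∣S∣
  ... | j , j' , j≢j' , j∈S , j'∈S = subst (_≤ rank c S) (∣pair∣≡2 j≢j')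
        (rank-≥ c S (pair j j') (pair-⊆ j∈S j'∈S)
          (pair-independent j≢j' loopless (λ cj≡cj' → simple (j , j' , j≢j' , cj≡cj'))))
  rank-≥-size loopless simple S (suc (suc (suc k))) (s≤s (s≤s ())) _

  parallel⇒circuit₂ : Loopless → ParallelPair → HasCircuitOfSize2 c
  parallel⇒circuit₂ loopless (j , j' , j≢j' , cj≡cj') =
    pair j j' , (pair-dependent j≢j' cj≡cj' , proper-independent) , ∣pair∣≡2 j≢j'
    where
    proper-independent : ∀ T → T ⊂ pair j j' → Independent c T
    proper-independent T T⊂ = small-independent loopless T
      (≤-pred (subst (∣ T ∣ <_) (∣pair∣≡2 j≢j') (p⊂q⇒∣p∣<∣q∣ T⊂)))

  circuit₂⇒parallel : Loopless → HasCircuitOfSize2 c → ParallelPair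
  circuit₂⇒parallel loopless (C , (dep , _) , ∣C∣≡2) with pick-two C (≤-reflexive (≡.sym ∣C∣≡2))
  ... | j , j' , j≢j' , j∈C , j'∈C with ≡-dec _≟_ (c j) (c j')
  ...   | yes cj≡cj' = j , j' , j≢j' , cj≡cj'
  ...   | no  cj≢cj' = contradiction (subst (Independent c) (pair-≡ j≢j' j∈C j'∈C ∣C∣≡2)
                          (pair-independent j≢j' loopless cj≢cj')) dep

  parallel⇒¬3-connected : ParallelPair → 4 ≤ m → ¬ ThreeConnected c
  parallel⇒¬3-connected (j , j' , j≢j' , cj≡cj') 4≤m 3-conn =
    3-conn 2 (pair j j') (s≤s (s≤s (s≤s z≤n)))
      ( pair-separation j≢j' cj≡cj'
      , ≤-reflexive (≡.sym (∣pair∣≡2 j≢j'))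
      , subst (2 ≤_) (≡.sym (∣∁pair∣ j≢j')) (∸-monoˡ-≤ 2 4≤m) )

  -- It is even a cyclic 2-separation: its complement has more than r(M) elements.
  parallel⇒¬cyclically-3-connected : ParallelPair → ¬ CyclicallyThreeConnected c
  parallel⇒¬cyclically-3-connected (j , j' , j≢j' , cj≡cj') (no-cyclic-sep , 3+r≤m) =
    no-cyclic-sep 2 (pair j j') (s≤s (s≤s (s≤s z≤n)))
      (pair-separation j≢j' cj≡cj' , pair-dependent j≢j' cj≡cj' , complement-dependent)
    where
    complement-dependent : Dependent c (∁ (pair j j'))
    complement-dependent ind = <⇒≱ (subst (rank c ⊤ <_) (≡.sym (∣∁pair∣ j≢j')) (∸-monoˡ-≤ 2 3+r≤m))
                                 (rank-≥ c ⊤ _ ⊆⊤ ind)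

  NoSmallSeparation : Set
  NoSmallSeparation = ∀ S k → k ≤ 2 → k ≤ ∣ S ∣ → k ≤ ∣ ∁ S ∣ → k + rank c ⊤ ≤ rank c S + rank c (∁ S)

  no-small-separation⇒3-connected : NoSmallSeparation → ThreeConnected c
  no-small-separation⇒3-connected robust k S k<3 (λ<k , k≤∣S∣ , k≤∣∁S∣) =
    <⇒≱ λ<k (robust S k (≤-pred k<3) k≤∣S∣ k≤∣∁S∣)

  -- Dependent sides of a loopless matroid have size ≥ 2, so cyclic separations
  -- of order < 3 are ordinary ones.
  no-small-separation⇒cyclically-3-connected :
    Loopless → NoSmallSeparation → 3 + rank c ⊤ ≤ m → CyclicallyThreeConnected c
  no-small-separation⇒cyclically-3-connected loopless robust 3+r≤m = no-cyclic-sep , 3+r≤m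
    where
    no-cyclic-sep : ∀ k S → k < 3 → ¬ CyclicSep c k S
    no-cyclic-sep k S k<3 (λ<k , dep-S , dep-∁S) =
      <⇒≱ λ<k (robust S k (≤-pred k<3) (≤-trans (≤-pred k<3) (dependent⇒≥2 loopless S dep-S))
                                        (≤-trans (≤-pred k<3) (dependent⇒≥2 loopless (∁ S) dep-∁S)))

module _ {n : ℕ} (G : Graph n) (connected : Connected G) where

  edge-leaving : ∀ Z {v w} → v ∈ Z → w ∉ Z → ∃[ u ] ∃[ y ] (u ∈ Z × y ∉ Z × Nbr G u y)
  edge-leaving Z {v} {w} v∈Z w∉Z = walk (connected v w) v∈Z
    where
    walk : ∀ {x} → Star (Nbr G) x w → x ∈ Z → ∃[ u ] ∃[ y ] (u ∈ Z × y ∉ Z × Nbr G u y)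
    walk ε x∈Z = contradiction x∈Z w∉Z
    walk (_◅_ {j = y} xy rest) x∈Z with y ∈? Z
    ... | yes y∈Z = walk rest y∈Z
    ... | no  y∉Z = _ , y , x∈Z , y∉Z , xy

  has-neighbour : 1 < n → ∀ v → ∃[ u ] Nbr G v u
  has-neighbour 1<n v = first-step (connected v (another 1<n v)) (another-≢ 1<n v)
    where
    another : ∀ {k} → 1 < k → Fin k → Fin k
    another {suc (suc k)} _ zero    = suc zero
    another {suc (suc k)} _ (suc _) = zero
    another {suc zero} (s≤s ()) _
    another-≢ : ∀ {k} (1<k : 1 < k) v → another 1<k v ≢ v
    another-≢ {suc (suc k)} _ zero    ()
    another-≢ {suc (suc k)} _ (suc _) ()
    another-≢ {suc zero} (s≤s ()) _
    first-step : ∀ {w} → Star (Nbr G) v w → w ≢ v → ∃[ u ] Nbr G v u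
    first-step ε          w≢v = contradiction refl w≢v
    first-step (vu ◅ _)   _   = _ , vu

xor-cancelˡ : ∀ x y → x xor (x xor y) ≡ y
xor-cancelˡ x y = trans (≡.sym (xor-assoc x x y)) (cong (_xor y) (xor-same x))

xor-injectiveʳ : ∀ x {y z} → x xor y ≡ x xor z → y ≡ z
xor-injectiveʳ x {y} {z} eq = trans (≡.sym (xor-cancelˡ x y)) (trans (cong (x xor_) eq) (xor-cancelˡ x z))

δ : ∀ {n} → Fin n → Fin n → Bool
δ u v = ⌊ u ≟ᶠ v ⌋

δ-refl : ∀ {n} (v : Fin n) → δ v v ≡ true
δ-refl v with v ≟ᶠ v
... | yes _   = refl
... | no  v≢v = contradiction refl v≢v

δ-≢ : ∀ {n} {u v : Fin n} → u ≢ v → δ u v ≡ false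
δ-≢ {u = u} {v} u≢v with u ≟ᶠ v
... | yes u≡v = contradiction u≡v u≢v
... | no  _   = refl

δ⇒≡ : ∀ {n} {u v : Fin n} → δ u v ≡ true → u ≡ v
δ⇒≡ {u = u} {v} δ≡true with u ≟ᶠ v
... | yes u≡v = u≡v

joined : ∀ {m k x} {i : Fin (m + k)} → splitAt m i ≡ x → join m k x ≡ i
joined {m} {k} {i = i} eq = trans (cong (join m k) (≡.sym eq)) (join-splitAt m k i)

module IASMatrix {n : ℕ} (G : Graph n) where

  M : Columns n (n + (n + n))
  M = IAS G

  e : Fin n → Fin (n + (n + n))
  e v = v ↑ˡ (n + n)

  block : Fin n → Bool → Fin (n + n)
  block v false = v ↑ˡ n
  block v true  = n ↑ʳ v

  -- The element carrying column v of A(G) (b = false) or of A(G) + I (b = true).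
  a : Fin n → Bool → Fin (n + (n + n))
  a v b = n ↑ʳ block v b

  data Element : Fin (n + (n + n)) → Set where
    identity  : ∀ v → Element (e v)
    adjacency : ∀ v b → Element (a v b)

  classify : ∀ j → Element j
  classify j with splitAt n j in split-j
  ... | inj₁ v = subst Element (joined split-j) (identity v)
  ... | inj₂ j' with splitAt n j' in split-j'
  ...   | inj₁ v = subst Element (trans (cong (n ↑ʳ_) (joined split-j')) (joined split-j)) (adjacency v false)
  ...   | inj₂ v = subst Element (trans (cong (n ↑ʳ_) (joined split-j')) (joined split-j)) (adjacency v true)

  e≢a : ∀ {v w b} → e v ≢ a w b
  e≢a {v} {w} {b} eq
    with trans (≡.sym (splitAt-↑ˡ n v (n + n))) (trans (cong (splitAt n) eq) (splitAt-↑ʳ n (n + n) _))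
  ... | ()

  a-injective : ∀ {v w b b'} → a v b ≡ a w b' → v ≡ w × b ≡ b'
  a-injective {v} {w} {b} {b'} eq = blocks b b' (↑ʳ-injective n _ _ eq)
    where
    blocks : ∀ b b' → block v b ≡ block w b' → v ≡ w × b ≡ b'
    blocks false false eq' = ↑ˡ-injective n v w eq' , refl
    blocks true  true  eq' = ↑ʳ-injective n v w eq' , refl
    blocks false true  eq' with trans (≡.sym (splitAt-↑ˡ n v n)) (trans (cong (splitAt n) eq') (splitAt-↑ʳ n n w))
    ... | ()
    blocks true  false eq' with trans (≡.sym (splitAt-↑ʳ n n v)) (trans (cong (splitAt n) eq') (splitAt-↑ˡ n w n))
    ... | ()

  e-column : ∀ v u → lookup (M (e v)) u ≡ δ u v
  e-column v u rewrite splitAt-↑ˡ n v (n + n) = lookup∘tabulate _ u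

  a-column : ∀ v b u → lookup (M (a v b)) u ≡ adj G u v xor (b ∧ δ u v)
  a-column v false u rewrite splitAt-↑ʳ n (n + n) (v ↑ˡ n) | splitAt-↑ˡ n v n =
    trans (lookup∘tabulate _ u) (≡.sym (xor-identityʳ _))
  a-column v true  u rewrite splitAt-↑ʳ n (n + n) (n ↑ʳ v) | splitAt-↑ʳ n n v = lookup∘tabulate _ u

  a-off-diagonal : ∀ {u v} b → u ≢ v → lookup (M (a v b)) u ≡ adj G u v
  a-off-diagonal {u} {v} b u≢v =
    trans (a-column v b u) (trans (cong (λ x → adj G u v xor (b ∧ x)) (δ-≢ u≢v))
      (trans (cong (adj G u v xor_) (∧-zeroʳ b)) (xor-identityʳ _)))

  a-diagonal : ∀ v b → lookup (M (a v b)) v ≡ adj G v v xor b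
  a-diagonal v b = trans (a-column v b v)
    (trans (cong (λ x → adj G v v xor (b ∧ x)) (δ-refl v)) (cong (adj G v v xor_) (∧-identityʳ b)))

  -- e_v + a_v = a_v + e_v: any two of the three columns of v span the third.
  triangle : ∀ v → M (e v) ⊕ M (a v false) ≡ M (a v true)
  triangle v = vec-ext λ u → begin
    lookup (M (e v) ⊕ M (a v false)) u               ≡⟨ lookup-⊕ (M (e v)) _ u ⟩
    lookup (M (e v)) u xor lookup (M (a v false)) u  ≡⟨ cong₂ _xor_ (e-column v u) (a-column v false u) ⟩
    δ u v xor (adj G u v xor false)                  ≡⟨ cong (δ u v xor_) (xor-identityʳ _) ⟩
    δ u v xor adj G u v                              ≡⟨ xor-comm (δ u v) _ ⟩
    adj G u v xor δ u v                              ≡⟨ ≡.sym (a-column v true u) ⟩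
    lookup (M (a v true)) u                          ∎
    where open ≡-Reasoning

  eSet : Subset n → Subset (n + (n + n))
  eSet Z = Z ++ ⊥

  e∈eSet : ∀ {Z v} → v ∈ Z → e v ∈ eSet Z
  e∈eSet {Z} {v} v∈Z = lookup⇒∈ (trans (lookup-++ˡ Z ⊥ v) (∈⇒lookup v∈Z))

  eSet-members : ∀ {Z j} → j ∈ eSet Z → ∃[ v ] (j ≡ e v × v ∈ Z)
  eSet-members {Z} {j} j∈ with classify j
  ... | identity v    = v , refl , lookup⇒∈ (trans (≡.sym (lookup-++ˡ Z ⊥ v)) (∈⇒lookup j∈))
  ... | adjacency v b
    with trans (≡.sym (trans (lookup-++ʳ Z ⊥ (block v b)) (lookup-zeroVec (block v b)))) (∈⇒lookup j∈)
  ...   | ()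

  eSet-mono : ∀ {Z Z'} → Z ⊆ Z' → eSet Z ⊆ eSet Z'
  eSet-mono Z⊆Z' j∈ with eSet-members j∈
  ... | v , refl , v∈Z = e∈eSet (Z⊆Z' v∈Z)

  ∣eSet∣ : ∀ Z → ∣ eSet Z ∣ ≡ ∣ Z ∣
  ∣eSet∣ = size
    where
    size : ∀ {k l} (Z : Subset k) → ∣ Z ++ ⊥ {l} ∣ ≡ ∣ Z ∣
    size {l = l} []  = ∣⊥∣≡0 l
    size (true ∷ Z)  = cong suc (size Z)
    size (false ∷ Z) = size Z

  eSet-sum : ∀ w → colSum M (eSet w) ≡ w
  eSet-sum w = vec-ext entry
    where
    entry : ∀ u → lookup (colSum M (eSet w)) u ≡ lookup w u
    entry u with lookup w u in wᵤ
    ... | true  = pivot-entry M (eSet w) (e u) u (e∈eSet (lookup⇒∈ wᵤ)) (trans (e-column u u) (δ-refl u)) others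
      where
      others : ∀ j → j ∈ eSet w → j ≢ e u → lookup (M j) u ≡ false
      others j j∈ j≢eu with eSet-members j∈
      ... | v , refl , _ = trans (e-column v u) (δ-≢ (λ u≡v → j≢eu (cong e (≡.sym u≡v))))
    ... | false = zero-entry M (eSet w) u zeros
      where
      zeros : ∀ j → j ∈ eSet w → lookup (M j) u ≡ false
      zeros j j∈ with eSet-members j∈
      ... | v , refl , v∈w = trans (e-column v u) (δ-≢ u≢v)
        where
        u≢v : u ≢ v
        u≢v refl with trans (≡.sym wᵤ) (∈⇒lookup v∈w)
        ... | ()

  -- The identity columns are independent: row v singles out e_v.
  eSet-independent : ∀ Z → Independent M (eSet Z)
  eSet-independent Z = independent-intro M (eSet Z) no-zero-sum
    where
    no-zero-sum : ∀ U → U ⊆ eSet Z → Nonempty U → colSum M U ≢ zeroVec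
    no-zero-sum U U⊆ (j , j∈U) with eSet-members (U⊆ j∈U)
    ... | v , refl , _ = nonzero-at v (pivot-entry M U (e v) v j∈U (trans (e-column v v) (δ-refl v)) others)
      where
      others : ∀ j' → j' ∈ U → j' ≢ e v → lookup (M j') v ≡ false
      others j' j'∈ j'≢ev with eSet-members (U⊆ j'∈)
      ... | v' , refl , _ = trans (e-column v' v) (δ-≢ (λ v≡v' → j'≢ev (cong e (≡.sym v≡v'))))

  -- r(M) ≤ n: the identity columns span everything.
  rank-≤-n : ∀ S → rank M S ≤ n
  rank-≤-n S = subst (rank M S ≤_) (trans (∣eSet∣ ⊤) (∣⊤∣≡n n))
    (rank-≤-spanning M S (eSet ⊤) (λ j _ → eSet (M j) , eSet-mono ⊆⊤ , eSet-sum (M j)))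

  -- v is heavy in S if S contains at least two of e_v, a_v, a_v + e_v; then S
  -- spans all three.  Exactly one of S and ∁ S makes v heavy.
  majority : Bool → Bool → Bool → Bool
  majority x y z = (x ∧ y) ∨ ((x ∧ z) ∨ (y ∧ z))

  majority-not : ∀ x y z → majority (not x) (not y) (not z) ≡ not (majority x y z)
  majority-not false false false = refl
  majority-not false false true  = refl
  majority-not false true  false = refl
  majority-not false true  true  = refl
  majority-not true  false false = refl
  majority-not true  false true  = refl
  majority-not true  true  false = refl
  majority-not true  true  true  = refl

  heavy : Subset (n + (n + n)) → Fin n → Bool
  heavy S v = majority (lookup S (e v)) (lookup S (a v false)) (lookup S (a v true))

  heavy-∁ : ∀ S v → heavy (∁ S) v ≡ not (heavy S v)
  heavy-∁ S v rewrite lookup-map (e v) not S | lookup-map (a v false) not S | lookup-map (a v true) not S =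
    majority-not (lookup S (e v)) (lookup S (a v false)) (lookup S (a v true))

  -- If v is heavy in S, then S spans e_v and a_v (indeed all three columns of v),
  -- since any two of them sum to the third.
  heavy-spans : ∀ S v → heavy S v ≡ true → InSpan M S (M (e v)) × InSpan M S (M (a v false))
  heavy-spans S v heavy-v with lookup S (e v) in S∋e | lookup S (a v false) in S∋a | lookup S (a v true) in S∋a+e
  ... | true  | true  | _     = span-col M (e v) (lookup⇒∈ S∋e) , span-col M (a v false) (lookup⇒∈ S∋a)
  ... | true  | false | true  =
    span-e , subst (InSpan M S) (≡.sym (⊕-moveˡ _ _ _ (triangle v))) (span-⊕ M span-e span-a+e)
    where
    span-e : InSpan M S (M (e v))
    span-e = span-col M (e v) (lookup⇒∈ S∋e)
    span-a+e : InSpan M S (M (a v true))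
    span-a+e = span-col M (a v true) (lookup⇒∈ S∋a+e)
  ... | false | true  | true  = subst (InSpan M S) e≡a⊕[a+e] (span-⊕ M span-a span-a+e) , span-a
    where
    span-a : InSpan M S (M (a v false))
    span-a = span-col M (a v false) (lookup⇒∈ S∋a)
    span-a+e : InSpan M S (M (a v true))
    span-a+e = span-col M (a v true) (lookup⇒∈ S∋a+e)
    e≡a⊕[a+e] : M (a v false) ⊕ M (a v true) ≡ M (e v)
    e≡a⊕[a+e] = ≡.sym (⊕-moveˡ _ _ _ (trans (⊕-comm (M (a v false)) (M (e v))) (triangle v)))
  ... | true  | false | false with heavy-v
  ...   | ()
  heavy-spans S v heavy-v | false | true  | false with heavy-v
  ...   | ()
  heavy-spans S v heavy-v | false | false | _     with heavy-v
  ...   | ()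

  heavy-in-∁ : ∀ S {v} → heavy S v ≢ true → heavy (∁ S) v ≡ true
  heavy-in-∁ S {v} not-heavy = trans (heavy-∁ S v) (cong not (¬-not not-heavy))

  heavySet : Subset (n + (n + n)) → Subset n
  heavySet S = tabulate (heavy S)

  heavy⇒∈ : ∀ S {v} → heavy S v ≡ true → v ∈ heavySet S
  heavy⇒∈ S {v} h = lookup⇒∈ (trans (lookup∘tabulate (heavy S) v) h)

  ∈⇒heavy : ∀ S {v} → v ∈ heavySet S → heavy S v ≡ true
  ∈⇒heavy S {v} v∈ = trans (≡.sym (lookup∘tabulate (heavy S) v)) (∈⇒lookup v∈)

  full-rank : ∀ S → (∀ v → heavy S v ≡ true) → n ≤ rank M S
  full-rank S all-heavy = subst (_≤ rank M S) (trans (∣eSet∣ ⊤) (∣⊤∣≡n n))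
    (independent-in-span-≤-rank M S (eSet ⊤) (eSet-independent ⊤) spanned)
    where
    spanned : ∀ j → j ∈ eSet ⊤ → InSpan M S (M j)
    spanned j j∈ with eSet-members j∈
    ... | v , refl , _ = proj₁ (heavy-spans S v (all-heavy v))

  -- If the vertices in Z are heavy in S and an edge uy leaves Z, then
  -- {e_v | v ∈ Z} ∪ {a_u} is independent (a_u is the only one with a 1 in
  -- row y) and spanned by S.
  cut-rank : ∀ S Z {u y} → (∀ v → v ∈ Z → heavy S v ≡ true) → u ∈ Z → y ∉ Z → adj G u y ≡ true →
    suc ∣ Z ∣ ≤ rank M S
  cut-rank S Z {u} {y} Z-heavy u∈Z y∉Z uy = begin
    suc ∣ Z ∣                      ≡⟨ cong suc (≡.sym (∣eSet∣ Z)) ⟩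
    suc ∣ eSet Z ∣                 ≤⟨ p⊂q⇒∣p∣<∣q∣ (x∈p∪q⁺ ∘ inj₁ , a u false , x∈p∪q⁺ (inj₂ (x∈⁅x⁆ _)) , au∉eSet) ⟩
    ∣ eSet Z ∪ ⁅ a u false ⁆ ∣      ≤⟨ independent-in-span-≤-rank M S _ independent spanned ⟩
    rank M S                       ∎
    where
    open ≤-Reasoning
    au∉eSet : a u false ∉ eSet Z
    au∉eSet au∈ with eSet-members au∈
    ... | v , au≡ev , _ = e≢a {v} {u} {false} (≡.sym au≡ev)
    y≢u : y ≢ u
    y≢u refl = y∉Z u∈Z
    -- No combination of the e_v (v ∈ Z) has a 1 in row y, but a_u does.
    au∉span : ¬ InSpan M (eSet Z) (M (a u false))
    au∉span (U , U⊆ , ΣU≡au) =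
      contradiction (trans (≡.sym (zero-entry M U y zeros)) (trans (cong (λ w → lookup w y) ΣU≡au) row-y)) λ ()
      where
      row-y : lookup (M (a u false)) y ≡ true
      row-y = trans (a-off-diagonal false y≢u) (trans (Graph.sym G y u) uy)
      zeros : ∀ j → j ∈ U → lookup (M j) y ≡ false
      zeros j j∈ with eSet-members (U⊆ j∈)
      ... | v , refl , v∈Z = trans (e-column v y) (δ-≢ (λ { refl → y∉Z v∈Z }))
    independent : Independent M (eSet Z ∪ ⁅ a u false ⁆)
    independent = independent-extend M (eSet Z) (a u false) (eSet-independent Z) au∉span
    spanned : ∀ j → j ∈ eSet Z ∪ ⁅ a u false ⁆ → InSpan M S (M j)
    spanned j j∈ with x∈p∪q⁻ (eSet Z) ⁅ a u false ⁆ j∈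
    ... | inj₂ j∈⁅au⁆ rewrite x∈⁅y⁆⇒x≡y (a u false) j∈⁅au⁆ = proj₂ (heavy-spans S u (Z-heavy u u∈Z))
    ... | inj₁ j∈eSet with eSet-members j∈eSet
    ...   | v , refl , v∈Z = proj₁ (heavy-spans S v (Z-heavy v v∈Z))

  -- No column of M is zero: e_v has a 1 in row v, and a_v + b e_v has a 1 in the
  -- row of any neighbour of v.
  loopless : Connected G → 1 < n → Loopless M
  loopless connected 1<n j with classify j
  ... | identity v    = nonzero-at v (trans (e-column v v) (δ-refl v))
  ... | adjacency v b with has-neighbour G connected 1<n v
  ...   | u , u≢v , vu = nonzero-at u (trans (a-off-diagonal b u≢v) (trans (Graph.sym G u v) vu))

  no-small-separation : Connected G → 1 < n → ¬ ParallelPair M → NoSmallSeparation M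
  no-small-separation connected 1<n simple S k k≤2 k≤∣S∣ k≤∣∁S∣
    with any? (λ v → heavy S v ≟ true) | any? (λ v → heavy S v ≟ false)
  ... | no no-heavy | _ =
    +-mono-≤ (rank-≥-size M (loopless connected 1<n) simple S k k≤2 k≤∣S∣)
             (≤-trans (rank-≤-n ⊤) (full-rank (∁ S) (λ v → heavy-in-∁ S (λ h → no-heavy (v , h)))))
  ... | yes _ | no no-light =
    subst (_≤ rank M S + rank M (∁ S)) (+-comm (rank M ⊤) k)
      (+-mono-≤ (≤-trans (rank-≤-n ⊤) (full-rank S (λ v → ¬-not (λ h → no-light (v , h)))))
                (rank-≥-size M (loopless connected 1<n) simple (∁ S) k k≤2 k≤∣∁S∣))
  ... | yes (v , v-heavy) | yes (w , w-light)
    with edge-leaving G connected (heavySet S) (heavy⇒∈ S v-heavy)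
           (λ w∈ → contradiction (trans (≡.sym w-light) (∈⇒heavy S w∈)) λ ())
  ...   | u , y , u∈X , y∉X , _ , uy = begin
    k + rank M ⊤                        ≤⟨ +-mono-≤ k≤2 (rank-≤-n ⊤) ⟩
    2 + n                               ≡⟨ cong (2 +_) (≡.sym ∣X∣+∣∁X∣) ⟩
    2 + (∣ X ∣ + ∣ ∁ X ∣)                 ≡⟨ cong suc (≡.sym (+-suc ∣ X ∣ ∣ ∁ X ∣)) ⟩
    suc ∣ X ∣ + suc ∣ ∁ X ∣               ≤⟨ +-mono-≤ rank-S rank-∁S ⟩
    rank M S + rank M (∁ S)             ∎
    where
    open ≤-Reasoning
    X : Subset n
    X = heavySet S
    ∣X∣+∣∁X∣ : ∣ X ∣ + ∣ ∁ X ∣ ≡ n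
    ∣X∣+∣∁X∣ = trans (cong (∣ X ∣ +_) (∣∁p∣≡n∸∣p∣ X)) (m+[n∸m]≡n (∣p∣≤n X))
    rank-S : suc ∣ X ∣ ≤ rank M S
    rank-S = cut-rank S X (λ _ → ∈⇒heavy S) u∈X y∉X uy
    rank-∁S : suc ∣ ∁ X ∣ ≤ rank M (∁ S)
    rank-∁S = cut-rank (∁ S) (∁ X) (λ _ v∈∁X → heavy-in-∁ S (x∈∁p⇒x∉p v∈∁X ∘ heavy⇒∈ S))
                (x∉p⇒x∈∁p y∉X) (x∈p⇒x∉∁p u∈X) (trans (Graph.sym G y u) uy)

  -- Parallel pairs of M are pendant vertices and twins of G

  PendantOrTwins : Set
  PendantOrTwins = (∃[ v ] Pendant G v) ⊎ (∃[ v ] ∃[ w ] Twins G v w)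

  twins-intro : ∀ {v w} → v ≢ w → (∀ x → x ≢ v → x ≢ w → adj G v x ≡ adj G w x) → Twins G v w
  twins-intro {v} {w} v≢w same = v≢w , λ x → mk⇔
    (λ { ((x≢v , vx) , x≢w) → (x≢w , trans (≡.sym (same x x≢v x≢w)) vx) , x≢v })
    (λ { ((x≢w , wx) , x≢v) → (x≢v , trans (same x x≢v x≢w) wx) , x≢w })

  twins-elim : ∀ {v w} → Twins G v w → ∀ x → x ≢ v → x ≢ w → adj G v x ≡ adj G w x
  twins-elim {v} {w} (_ , same-nbrs) x x≢v x≢w with adj G v x in vx | adj G w x in wx
  ... | true  | true  = refl
  ... | false | false = refl
  ... | true  | false =
    contradiction (trans (≡.sym wx) (proj₂ (proj₁ (Equivalence.to (same-nbrs x) ((x≢v , vx) , x≢w))))) λ ()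
  ... | false | true  =
    contradiction (trans (≡.sym vx) (proj₂ (proj₁ (Equivalence.from (same-nbrs x) ((x≢w , wx) , x≢v))))) λ ()

  module _ (connected : Connected G) (1<n : 1 < n) where

    -- e_w = a_v + b e_v: off the diagonal, row x of column v of A(G) is δ x w,
    -- so N(v) = {w}.  (w ≠ v because v has a neighbour.)
    identity-column⇒pendant : ∀ {w v b} → M (e w) ≡ M (a v b) → Pendant G v
    identity-column⇒pendant {w} {v} {b} eq = w , λ x → mk⇔
      (λ { (x≢v , vx) → δ⇒≡ (trans (off-diagonal x x≢v) (trans (Graph.sym G x v) vx)) })
      (λ { refl → w≢v , trans (Graph.sym G v w) (trans (≡.sym (off-diagonal w w≢v)) (δ-refl w)) })
      where
      off-diagonal : ∀ x → x ≢ v → δ x w ≡ adj G x v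
      off-diagonal x x≢v =
        trans (≡.sym (e-column w x)) (trans (cong (λ c → lookup c x) eq) (a-off-diagonal b x≢v))
      w≢v : w ≢ v
      w≢v refl with has-neighbour G connected 1<n w
      ... | u , u≢w , wu = contradiction
              (trans (≡.sym (δ-≢ u≢w)) (trans (off-diagonal u u≢w) (trans (Graph.sym G u w) wu))) λ ()

    adjacency-columns⇒twins : ∀ {v w b b'} → v ≢ w → M (a v b) ≡ M (a w b') → Twins G v w
    adjacency-columns⇒twins {v} {w} {b} {b'} v≢w eq = twins-intro v≢w λ x x≢v x≢w →
      trans (Graph.sym G v x) (trans (≡.sym (a-off-diagonal b x≢v))
        (trans (cong (λ c → lookup c x) eq) (trans (a-off-diagonal b' x≢w) (Graph.sym G x w))))

    -- a_v and a_v + e_v differ in row v.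
    adjacency-columns-same-vertex : ∀ {v b b'} → M (a v b) ≡ M (a v b') → b ≡ b'
    adjacency-columns-same-vertex {v} {b} {b'} eq = xor-injectiveʳ (adj G v v)
      (trans (≡.sym (a-diagonal v b)) (trans (cong (λ c → lookup c v) eq) (a-diagonal v b')))

    parallel⇒pendant-or-twins : ParallelPair M → PendantOrTwins
    parallel⇒pendant-or-twins (j , j' , j≢j' , eq) with classify j | classify j'
    ... | identity w    | identity w'   =
      contradiction (cong e (δ⇒≡ (trans (≡.sym (e-column w' w)) (trans (cong (λ c → lookup c w) (≡.sym eq))
                       (trans (e-column w w) (δ-refl w)))))) j≢j'
    ... | identity w    | adjacency v b = inj₁ (v , identity-column⇒pendant {w} {v} {b} eq)
    ... | adjacency v b | identity w    = inj₁ (v , identity-column⇒pendant {w} {v} {b} (≡.sym eq))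
    ... | adjacency v b | adjacency w b' with v ≟ᶠ w
    ...   | no  v≢w  = inj₂ (v , w , adjacency-columns⇒twins {v} {w} {b} {b'} v≢w eq)
    ...   | yes refl = contradiction (cong (a v) (adjacency-columns-same-vertex {v} {b} {b'} eq)) j≢j'

  -- A pendant vertex v on w: e_w equals column v of A(G) or of A(G) + I,
  -- whichever has a 0 in row v.
  pendant⇒parallel : ∀ {v} → Pendant G v → ParallelPair M
  pendant⇒parallel {v} (w , N[v]≡w) = e w , a v (adj G v v) , e≢a {w} {v} {adj G v v} , vec-ext entry
    where
    v~w : Nbr G v w
    v~w = Equivalence.from (N[v]≡w w) refl
    entry : ∀ u → lookup (M (e w)) u ≡ lookup (M (a v (adj G v v))) u
    entry u with u ≟ᶠ v
    ... | yes refl = trans (e-column w u) (trans (δ-≢ (λ u≡w → proj₁ v~w (≡.sym u≡w)))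
                       (≡.sym (trans (a-diagonal u (adj G u u)) (xor-same (adj G u u)))))
    ... | no  u≢v  = trans (e-column w u)
                       (trans row (≡.sym (trans (a-off-diagonal (adj G v v) u≢v) (Graph.sym G u v))))
      where
      row : δ u w ≡ adj G v u
      row with adj G v u in vu
      ... | true  = trans (cong (λ x → δ x w) (Equivalence.to (N[v]≡w u) (u≢v , vu))) (δ-refl w)
      ... | false = δ-≢ λ { refl → contradiction (trans (≡.sym vu) (proj₂ v~w)) λ () }

  -- Twins v, w: columns a_v + (A_vv + A_vw) e_v and a_w + (A_ww + A_vw) e_w agree.
  twins⇒parallel : ∀ {v w} → Twins G v w → ParallelPair M
  twins⇒parallel {v} {w} twins@(v≢w , _) =
    a v bᵥ , a w b_w , (λ eq → v≢w (proj₁ (a-injective {v} {w} {bᵥ} {b_w} eq))) , vec-ext entry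
    where
    bᵥ b_w : Bool
    bᵥ = adj G v v xor adj G v w
    b_w = adj G w w xor adj G v w
    entry : ∀ u → lookup (M (a v bᵥ)) u ≡ lookup (M (a w b_w)) u
    entry u with u ≟ᶠ v | u ≟ᶠ w
    ... | yes refl | yes refl = contradiction refl v≢w
    ... | yes refl | no  u≢w  = begin
      lookup (M (a u bᵥ)) u          ≡⟨ a-diagonal u bᵥ ⟩
      adj G u u xor bᵥ              ≡⟨ xor-cancelˡ (adj G u u) (adj G u w) ⟩
      adj G u w                     ≡⟨ ≡.sym (a-off-diagonal b_w u≢w) ⟩
      lookup (M (a w b_w)) u         ∎
      where open ≡-Reasoning
    ... | no  u≢v  | yes refl = begin
      lookup (M (a v bᵥ)) u          ≡⟨ a-off-diagonal bᵥ u≢v ⟩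
      adj G u v                     ≡⟨ Graph.sym G u v ⟩
      adj G v u                     ≡⟨ ≡.sym (xor-cancelˡ (adj G u u) (adj G v u)) ⟩
      adj G u u xor b_w             ≡⟨ ≡.sym (a-diagonal u b_w) ⟩
      lookup (M (a u b_w)) u         ∎
      where open ≡-Reasoning
    ... | no  u≢v  | no  u≢w  = begin
      lookup (M (a v bᵥ)) u          ≡⟨ a-off-diagonal bᵥ u≢v ⟩
      adj G u v                     ≡⟨ Graph.sym G u v ⟩
      adj G v u                     ≡⟨ twins-elim twins u u≢v u≢w ⟩
      adj G w u                     ≡⟨ Graph.sym G w u ⟩
      adj G u w                     ≡⟨ ≡.sym (a-off-diagonal b_w u≢w) ⟩
      lookup (M (a w b_w)) u         ∎
      where open ≡-Reasoning

  pendant-or-twins⇒parallel : PendantOrTwins → ParallelPair M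
  pendant-or-twins⇒parallel (inj₁ (v , pendant))   = pendant⇒parallel pendant
  pendant-or-twins⇒parallel (inj₂ (v , w , twins)) = twins⇒parallel twins

  -- The dichotomy: a parallel pair, or no separation of order < 3

  module _ (connected : Connected G) (1<n : 1 < n) where

    -- 3n ≥ n + 3, so r(M) + 3 ≤ ∣ W ∣ and ∣ W ∣ ≥ 4.
    n+3≤∣W∣ : 3 + n ≤ n + (n + n)
    n+3≤∣W∣ = subst (_≤ n + (n + n)) (+-comm n 3) (+-monoʳ-≤ n (+-mono-≤ 1<n (≤-trans (s≤s z≤n) 1<n)))

    4≤∣W∣ : 4 ≤ n + (n + n)
    4≤∣W∣ = ≤-trans (s≤s (s≤s (s≤s (≤-trans (s≤s z≤n) 1<n)))) n+3≤∣W∣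

    ¬3-connected⇒parallel : ¬ ThreeConnected M → ParallelPair M
    ¬3-connected⇒parallel ¬3-conn with parallel? M
    ... | yes parallel = parallel
    ... | no  simple   = contradiction
      (no-small-separation⇒3-connected M (no-small-separation connected 1<n simple)) ¬3-conn

    ¬cyclically-3-connected⇒parallel : ¬ CyclicallyThreeConnected M → ParallelPair M
    ¬cyclically-3-connected⇒parallel ¬cyc with parallel? M
    ... | yes parallel = parallel
    ... | no  simple   = contradiction
      (no-small-separation⇒cyclically-3-connected M (loopless connected 1<n)
        (no-small-separation connected 1<n simple) (≤-trans (+-monoʳ-≤ 3 (rank-≤-n ⊤)) n+3≤∣W∣)) ¬cyc

proposition14 : ∀ {n} (G : Graph n) → Connected G → 1 < n →
    ((¬ ThreeConnected (IAS G)) ⇔ (¬ CyclicallyThreeConnected (IAS G)))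
    × ((¬ CyclicallyThreeConnected (IAS G)) ⇔ HasCircuitOfSize2 (IAS G))
    × (HasCircuitOfSize2 (IAS G) ⇔ ((∃[ v ] Pendant G v) ⊎ (∃[ v ] ∃[ w ] Twins G v w)))
proposition14 G connected 1<n =
    mk⇔ (parallel⇒¬cyclically-3-connected M ∘ ¬3-connected⇒parallel connected 1<n)
        (λ ¬cyc → parallel⇒¬3-connected M (¬cyclically-3-connected⇒parallel connected 1<n ¬cyc)
                    (4≤∣W∣ connected 1<n))
  , mk⇔ (parallel⇒circuit₂ M M-loopless ∘ ¬cyclically-3-connected⇒parallel connected 1<n)
        (parallel⇒¬cyclically-3-connected M ∘ circuit₂⇒parallel M M-loopless)
  , mk⇔ (parallel⇒pendant-or-twins connected 1<n ∘ circuit₂⇒parallel M M-loopless)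
        (parallel⇒circuit₂ M M-loopless ∘ pendant-or-twins⇒parallel)
  where
  open IASMatrix G
  M-loopless : Loopless M
  M-loopless = loopless connected 1<n
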